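{- Let $S$ be a finite linearly ordered set and $T\subseteq S$. Then the dual of $M_T(S)$ is $M_T(S)^*=M_{T'}(S_\varphi)$, where $T'=S\setminus T$ and $S_\varphi$ is $S$ with the reversed linear order. In particular, the class of freedom matroids is closed under duality.
   Context: For a linearly ordered finite set $S$ and $T=\{t_1<\dots<t_r\}\subseteq S$, $M_T(S)$ is the matroid on $S$ whose independent sets are the $I$ with $|I\cap T_i|\le i$ for $0\le i\le r$, where $T_r=S$ and $T_i=\{s\in S: s<t_{i+1}\}$ for $0\le i\le r-1$ (the ordering of $S$ used is the one given). A freedom matroid is a matroid of the form $M(S_0,\dots,S_r)$ for a flag $(S_0,\dots,S_r)$ on $S$ (i.e. $S_r=S$, $S_{i-1}\subsetneq S_i$), whose independent sets are the $I$ with $|I\cap S_i|\le i$ for all $i$. -}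

module Defs where

open import Level using (0ℓ)
open import Data.Nat using (ℕ; suc; _≤_)
open import Data.Empty using (⊥)
open import Data.Fin using (Fin; inject₁; fromℕ; toℕ) renaming (suc to fsuc)
open import Data.Fin.Subset using (Subset; _∈_; _⊆_; _⊂_; ∣_∣; _∩_; ⊤)
open import Data.Vec using (tabulate)
open import Data.Product using (Σ; _×_; ∃)
open import Relation.Binary.Core using (Rel)
open import Relation.Binary.Definitions using (Decidable)
open import Relation.Binary.PropositionalEquality using (_≡_)
open import Relation.Nullary using (does)
open import Function.Bundles using (_⇔_)

-- A finite linearly ordered set S is modelled as Fin n with a (decidable)
-- strict total order R.

Indep : ℕ → Set₁
Indep n = Subset n → Set

below : ∀ {n} {R : Rel (Fin n) 0ℓ} → Decidable R → Fin n → Subset n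
below R? t = tabulate (λ s → does (R? s t))

-- For t = t_{i+1} ∈ T we have i = |{t' ∈ T : t' < t}| and
-- T_i = {s : s < t_{i+1}}; the condition |I ∩ T_i| ≤ i for i < r is the
-- first component, and |I ∩ T_r| = |I| ≤ r = |T| is the second.
MT : ∀ {n} {R : Rel (Fin n) 0ℓ} → Decidable R → Subset n → Indep n
MT R? T I =
  (∀ t → t ∈ T → ∣ I ∩ below R? t ∣ ≤ ∣ T ∩ below R? t ∣) × ∣ I ∣ ≤ ∣ T ∣

IsBasis : ∀ {n} → Indep n → Subset n → Set
IsBasis Ind B = Ind B × (∀ J → Ind J → B ⊆ J → J ≡ B)

Dual : ∀ {n} → Indep n → Indep n
Dual Ind I = Σ (Subset _) λ B → IsBasis Ind B × (∀ {x} → x ∈ I → x ∈ B → ⊥)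

IsFlag : ∀ {n} (r : ℕ) → (Fin (suc r) → Subset n) → Set
IsFlag r F = F (fromℕ r) ≡ ⊤ × (∀ (i : Fin r) → F (inject₁ i) ⊂ F (fsuc i))

FreedomIndep : ∀ {n} (r : ℕ) → (Fin (suc r) → Subset n) → Indep n
FreedomIndep r F I = ∀ (i : Fin (suc r)) → ∣ I ∩ F i ∣ ≤ toℕ i

IsFreedom : ∀ {n} → Indep n → Set
IsFreedom {n} Ind =
  Σ ℕ λ r → Σ (Fin (suc r) → Subset n) λ F →
    IsFlag r F × (∀ I → Ind I ⇔ FreedomIndep r F I)

-- Independence in M_T(S) bounds ∣I ∩ {s ≤ t}∣ by ∣T ∩ {s ≤ t}∣ for every t, not only for t ∈ T.
-- A basis B has ∣T∣ elements, so it has at least as many elements above each t as T has; hence a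
-- set I disjoint from B has at most as many elements above t as S ∖ T, i.e. I is independent in
-- M_{S∖T}(S_φ). Conversely, for such an I the same counts show that S ∖ I has enough elements
-- above every t for a basis to be grown inside it greedily, always adding the largest remaining
-- element. A freedom matroid M(S_0, …, S_r) is M_T(S) for the order listing S_0, S_1 ∖ S_0, …
-- in turn, T consisting of the first element of each S_{i+1} ∖ S_i; and M_T(S) is the freedom
-- matroid of the flag T_0 ⊂ ⋯ ⊂ T_r.

module Submission where

open import Defs
open import Level using (0ℓ)
open import Data.Bool using (true; false)
open import Data.Empty using (⊥-elim)
open import Data.Fin as Fin
  using (Fin; zero; toℕ; fromℕ; fromℕ<; inject₁; combine) renaming (suc to fsuc)
open import Data.Fin.Properties as FinP
  using (toℕ<n; toℕ-fromℕ; toℕ-fromℕ<; toℕ-inject₁; toℕ-injective; combine-monoˡ-<; combine-injectiveʳ; any?)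
open import Data.Fin.Subset
open import Data.Fin.Subset.Properties
open import Data.List as List using (List; allFin)
open import Data.List.Relation.Unary.Any as Any using ()
open import Data.List.Membership.Propositional using () renaming (_∈_ to _∈ₗ_)
open import Data.List.Membership.Propositional.Properties using (∈-allFin)
open import Data.Nat as ℕ using (ℕ; suc; _+_; _≤_; _<_; z≤n; s≤s; s≤s⁻¹)
open import Data.Nat.Properties
open import Data.Product using (_×_; _,_; proj₁; proj₂; ∃)
open import Data.Sum using (_⊎_; inj₁; inj₂; [_,_]′; map₂)
open import Data.Vec using ([]; _∷_; tabulate; here; there)
open import Data.Vec.Properties using (lookup⇒[]=; []=⇒lookup; lookup∘tabulate)
open import Function using (flip; _∘_; _on_)
open import Function.Bundles using (_⇔_; mk⇔; Equivalence)
open import Function.Construct.Composition using (_⇔-∘_)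
open import Function.Construct.Symmetry using (⇔-sym)
open import Relation.Nullary using (Dec; yes; no; does; ¬_)
open import Relation.Nullary.Decidable using (dec-true)
open import Relation.Unary using (Pred)
open import Relation.Binary.Core using (Rel)
open import Relation.Binary.Definitions using (Decidable; tri<; tri≈; tri>)
open import Relation.Binary.Structures using (IsStrictTotalOrder)
open import Relation.Binary.Morphism.Structures using (IsOrderMonomorphism)
import Relation.Binary.Morphism.OrderMonomorphism as OrderMonomorphism
import Relation.Binary.Construct.StrictToNonStrict as StrictToNonStrict
import Relation.Binary.Construct.Flip.EqAndOrd as Flip
open import Relation.Binary.PropositionalEquality

∣p∩q∣+∣p∩∁q∣≡∣p∣ : ∀ {n} (p q : Subset n) → ∣ p ∩ q ∣ + ∣ p ∩ ∁ q ∣ ≡ ∣ p ∣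
∣p∩q∣+∣p∩∁q∣≡∣p∣ []            []            = refl
∣p∩q∣+∣p∩∁q∣≡∣p∣ (false ∷ p) (_     ∷ q) = ∣p∩q∣+∣p∩∁q∣≡∣p∣ p q
∣p∩q∣+∣p∩∁q∣≡∣p∣ (true  ∷ p) (true  ∷ q) = cong suc (∣p∩q∣+∣p∩∁q∣≡∣p∣ p q)
∣p∩q∣+∣p∩∁q∣≡∣p∣ (true  ∷ p) (false ∷ q) = trans (+-suc _ _) (cong suc (∣p∩q∣+∣p∩∁q∣≡∣p∣ p q))

∣p∪⁅x⁆∣≡1+∣p∣ : ∀ {n} {p : Subset n} {x} → x ∉ p → ∣ p ∪ ⁅ x ⁆ ∣ ≡ suc ∣ p ∣
∣p∪⁅x⁆∣≡1+∣p∣ {p = true  ∷ p} {zero}   x∉p = ⊥-elim (x∉p here)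
∣p∪⁅x⁆∣≡1+∣p∣ {p = false ∷ p} {zero}   _   = cong (suc ∘ ∣_∣) (∪-identityʳ p)
∣p∪⁅x⁆∣≡1+∣p∣ {p = true  ∷ p} {fsuc x} x∉p = cong suc (∣p∪⁅x⁆∣≡1+∣p∣ (x∉p ∘ there))
∣p∪⁅x⁆∣≡1+∣p∣ {p = false ∷ p} {fsuc x} x∉p = ∣p∪⁅x⁆∣≡1+∣p∣ (x∉p ∘ there)

∣p∩r∣+∣∁p∩r∣≡∣r∣ : ∀ {n} (p r : Subset n) → ∣ p ∩ r ∣ + ∣ ∁ p ∩ r ∣ ≡ ∣ r ∣
∣p∩r∣+∣∁p∩r∣≡∣r∣ p r = begin
  ∣ p ∩ r ∣ + ∣ ∁ p ∩ r ∣ ≡⟨ cong₂ _+_ (cong ∣_∣ (∩-comm p r)) (cong ∣_∣ (∩-comm (∁ p) r)) ⟩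
  ∣ r ∩ p ∣ + ∣ r ∩ ∁ p ∣ ≡⟨ ∣p∩q∣+∣p∩∁q∣≡∣p∣ r p ⟩
  ∣ r ∣                   ∎
  where open ≡-Reasoning

m+n≤o+p∧p≤n⇒m≤o : ∀ {m n o p} → m + n ≤ o + p → p ≤ n → m ≤ o
m+n≤o+p∧p≤n⇒m≤o {m} {n} {o} {p} m+n≤o+p p≤n =
  +-cancelʳ-≤ n m o (≤-trans m+n≤o+p (+-monoʳ-≤ o p≤n))

∣p∩r∣≤∣∁q∩r∣⇒∣q∩r∣≤∣∁p∩r∣ : ∀ {n} (p q r : Subset n) →
  ∣ p ∩ r ∣ ≤ ∣ ∁ q ∩ r ∣ → ∣ q ∩ r ∣ ≤ ∣ ∁ p ∩ r ∣
∣p∩r∣≤∣∁q∩r∣⇒∣q∩r∣≤∣∁p∩r∣ p q r = m+n≤o+p∧p≤n⇒m≤o (≤-reflexive (begin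
  ∣ q ∩ r ∣ + ∣ ∁ q ∩ r ∣ ≡⟨ ∣p∩r∣+∣∁p∩r∣≡∣r∣ q r ⟩
  ∣ r ∣                   ≡⟨ ∣p∩r∣+∣∁p∩r∣≡∣r∣ p r ⟨
  ∣ p ∩ r ∣ + ∣ ∁ p ∩ r ∣ ≡⟨ +-comm ∣ p ∩ r ∣ _ ⟩
  ∣ ∁ p ∩ r ∣ + ∣ p ∩ r ∣ ∎))
  where open ≡-Reasoning

∣p∣≤∣∁q∣⇒∣q∣≤∣∁p∣ : ∀ {n} (p q : Subset n) → ∣ p ∣ ≤ ∣ ∁ q ∣ → ∣ q ∣ ≤ ∣ ∁ p ∣
∣p∣≤∣∁q∣⇒∣q∣≤∣∁p∣ {n} p q = m+n≤o+p∧p≤n⇒m≤o (≤-reflexive (begin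
  ∣ q ∣ + ∣ ∁ q ∣ ≡⟨ ∣p∣+∣∁p∣≡n q ⟩
  n               ≡⟨ ∣p∣+∣∁p∣≡n p ⟨
  ∣ p ∣ + ∣ ∁ p ∣ ≡⟨ +-comm ∣ p ∣ _ ⟩
  ∣ ∁ p ∣ + ∣ p ∣ ∎))
  where
  open ≡-Reasoning
  ∣p∣+∣∁p∣≡n : (p : Subset n) → ∣ p ∣ + ∣ ∁ p ∣ ≡ n
  ∣p∣+∣∁p∣≡n p = trans (cong (∣ p ∣ +_) (∣∁p∣≡n∸∣p∣ p)) (m+[n∸m]≡n (∣p∣≤n p))

k+∣p∣≤∣q∣⇒k+∣p∩r∣≤∣q∩r∣ : ∀ {n} k (p q r : Subset n) →
  k + ∣ p ∣ ≤ ∣ q ∣ → ∣ q ∩ ∁ r ∣ ≤ ∣ p ∩ ∁ r ∣ → k + ∣ p ∩ r ∣ ≤ ∣ q ∩ r ∣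
k+∣p∣≤∣q∣⇒k+∣p∩r∣≤∣q∩r∣ k p q r k+∣p∣≤∣q∣ = m+n≤o+p∧p≤n⇒m≤o (begin
  k + ∣ p ∩ r ∣ + ∣ p ∩ ∁ r ∣   ≡⟨ +-assoc k _ _ ⟩
  k + (∣ p ∩ r ∣ + ∣ p ∩ ∁ r ∣) ≡⟨ cong (k +_) (∣p∩q∣+∣p∩∁q∣≡∣p∣ p r) ⟩
  k + ∣ p ∣                     ≤⟨ k+∣p∣≤∣q∣ ⟩
  ∣ q ∣                         ≡⟨ ∣p∩q∣+∣p∩∁q∣≡∣p∣ q r ⟨
  ∣ q ∩ r ∣ + ∣ q ∩ ∁ r ∣       ∎)
  where open ≤-Reasoning

p⊆q∧x∈q⇒p∪⁅x⁆⊆q : ∀ {n} {p q : Subset n} {x} → p ⊆ q → x ∈ q → p ∪ ⁅ x ⁆ ⊆ q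
p⊆q∧x∈q⇒p∪⁅x⁆⊆q {p = p} {q} {x} p⊆q x∈q y∈ =
  [ p⊆q , (λ y∈x → subst (_∈ q) (sym (x∈⁅y⁆⇒x≡y x y∈x)) x∈q) ]′ (x∈p∪q⁻ p ⁅ x ⁆ y∈)

p⊆q⇒∣p∣≤∣p∩q∣ : ∀ {n} {p q : Subset n} → p ⊆ q → ∣ p ∣ ≤ ∣ p ∩ q ∣
p⊆q⇒∣p∣≤∣p∩q∣ {p = p} p⊆q = p⊆q⇒∣p∣≤∣q∣ {p = p} λ x∈p → x∈p∩q⁺ (x∈p , p⊆q x∈p)

Empty⇒∣p∣≡0 : ∀ {n} {p : Subset n} → Empty p → ∣ p ∣ ≡ 0
Empty⇒∣p∣≡0 {n} empty = trans (cong ∣_∣ (Empty-unique empty)) (∣⊥∣≡0 n)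

p⊆q∧∣q∣≤∣p∣⇒q⊆p : ∀ {n} {p q : Subset n} → p ⊆ q → ∣ q ∣ ≤ ∣ p ∣ → q ⊆ p
p⊆q∧∣q∣≤∣p∣⇒q⊆p {p = p} p⊆q ∣q∣≤∣p∣ {x} x∈q with x ∈? p
... | yes x∈p = x∈p
... | no  x∉p = ⊥-elim (<⇒≱ (p⊂q⇒∣p∣<∣q∣ (p⊆q , x , x∈q , x∉p)) ∣q∣≤∣p∣)

∩-mono : ∀ {n} {p q r s : Subset n} → p ⊆ q → r ⊆ s → p ∩ r ⊆ q ∩ s
∩-mono {p = p} {r = r} p⊆q r⊆s x∈ with x∈p∩q⁻ p r x∈
... | x∈p , x∈r = x∈p∩q⁺ (p⊆q x∈p , r⊆s x∈r)

[p∪⁅x⁆]∩q⊆p∩q : ∀ {n} (p q : Subset n) {x} → x ∉ q → (p ∪ ⁅ x ⁆) ∩ q ⊆ p ∩ q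
[p∪⁅x⁆]∩q⊆p∩q p q {x} x∉q {y} y∈ with x∈p∩q⁻ (p ∪ ⁅ x ⁆) q y∈
... | y∈p∪x , y∈q = [ (λ y∈p → x∈p∩q⁺ (y∈p , y∈q))
                    , (λ y∈x → ⊥-elim (x∉q (subst (_∈ q) (x∈⁅y⁆⇒x≡y x y∈x) y∈q))) ]′
                    (x∈p∪q⁻ p ⁅ x ⁆ y∈p∪x)

[p∪⁅x⁆]∩q≡[p∩q]∪⁅x⁆ : ∀ {n} (p q : Subset n) {x} → x ∈ q → (p ∪ ⁅ x ⁆) ∩ q ≡ (p ∩ q) ∪ ⁅ x ⁆
[p∪⁅x⁆]∩q≡[p∩q]∪⁅x⁆ p q {x} x∈q = ⊆-antisym to from
  where
  to : (p ∪ ⁅ x ⁆) ∩ q ⊆ (p ∩ q) ∪ ⁅ x ⁆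
  to {y} y∈ with x∈p∩q⁻ (p ∪ ⁅ x ⁆) q y∈
  ... | y∈p∪x , y∈q = [ (λ y∈p → p⊆p∪q ⁅ x ⁆ (x∈p∩q⁺ (y∈p , y∈q))) , q⊆p∪q (p ∩ q) ⁅ x ⁆ ]′
                      (x∈p∪q⁻ p ⁅ x ⁆ y∈p∪x)
  from : (p ∩ q) ∪ ⁅ x ⁆ ⊆ (p ∪ ⁅ x ⁆) ∩ q
  from {y} y∈ = [ ∩-mono (p⊆p∪q ⁅ x ⁆) ⊆-refl
                , (λ y∈x → x∈p∩q⁺ (q⊆p∪q p ⁅ x ⁆ y∈x , subst (_∈ q) (sym (x∈⁅y⁆⇒x≡y x y∈x)) x∈q)) ]′
                (x∈p∪q⁻ (p ∩ q) ⁅ x ⁆ y∈)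

module _ {n} {P : Pred (Fin n) 0ℓ} (P? : ∀ x → Dec (P x)) where

  ∈-tabulate⁺ : ∀ {x} → P x → x ∈ tabulate (does ∘ P?)
  ∈-tabulate⁺ {x} px = lookup⇒[]= x _ (trans (lookup∘tabulate (does ∘ P?) x) (dec-true (P? x) px))

  ∈-tabulate⁻ : ∀ {x} → x ∈ tabulate (does ∘ P?) → P x
  ∈-tabulate⁻ {x} x∈ with P? x | trans (sym (lookup∘tabulate (does ∘ P?) x)) ([]=⇒lookup x∈)
  ... | yes px | _ = px
  ... | no _   | ()

module StrictTotalOrderFacts {a} {A : Set a} {_≺_ : Rel A 0ℓ} (sto : IsStrictTotalOrder _≡_ _≺_) where

  open IsStrictTotalOrder sto public
    using (compare; irrefl; asym) renaming (trans to ≺-trans; _<?_ to _≺?_)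
  open IsStrictTotalOrder sto using (<-respˡ-≈)
  private module NonStrict = StrictToNonStrict _≡_ _≺_
  open NonStrict public using () renaming (_≤_ to _≼_)

  ≼-≺-trans : ∀ {x y z} → x ≼ y → y ≺ z → x ≺ z
  ≼-≺-trans = NonStrict.≤-<-trans sym ≺-trans <-respˡ-≈

  ≼⇒⊁ : ∀ {x y} → x ≼ y → ¬ y ≺ x
  ≼⇒⊁ (inj₁ x≺y) y≺x = asym x≺y y≺x
  ≼⇒⊁ (inj₂ refl) x≺x = irrefl refl x≺x

  ⊀⇒≽ : ∀ {x y} → ¬ x ≺ y → y ≼ x
  ⊀⇒≽ {x} {y} x⊀y with compare x y
  ... | tri< x≺y _ _ = ⊥-elim (x⊀y x≺y)
  ... | tri≈ _ refl _ = inj₂ refl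
  ... | tri> _ _ y≺x = inj₁ y≺x

module Greatest {n} {_≺_ : Rel (Fin n) 0ℓ} (sto : IsStrictTotalOrder _≡_ _≺_) where
  open StrictTotalOrderFacts sto

  IsGreatest : Subset n → Fin n → Set
  IsGreatest X m = m ∈ X × (∀ {y} → y ∈ X → y ≼ m)

  greatestAmong : (X : Subset n) (xs : List (Fin n)) →
    (∀ {y} → y ∈ₗ xs → y ∉ X) ⊎ ∃ λ m → m ∈ X × (∀ {y} → y ∈ₗ xs → y ∈ X → y ≼ m)
  greatestAmong X List.[] = inj₁ λ ()
  greatestAmong X (x List.∷ xs) with x ∈? X | greatestAmong X xs
  ... | no x∉X  | inj₁ none = inj₁ λ { (Any.here refl) → x∉X ; (Any.there y∈) → none y∈ }
  ... | no x∉X  | inj₂ (m , m∈X , bounds) =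
    inj₂ (m , m∈X , λ { (Any.here refl) x∈X → ⊥-elim (x∉X x∈X) ; (Any.there y∈) → bounds y∈ })
  ... | yes x∈X | inj₁ none =
    inj₂ (x , x∈X , λ { (Any.here refl) _ → inj₂ refl ; (Any.there y∈) y∈X → ⊥-elim (none y∈ y∈X) })
  ... | yes x∈X | inj₂ (m , m∈X , bounds) with m ≺? x
  ...   | yes m≺x = inj₂ (x , x∈X , λ { (Any.here refl) _ → inj₂ refl
                                       ; (Any.there y∈) y∈X → inj₁ (≼-≺-trans (bounds y∈ y∈X) m≺x) })
  ...   | no m⊀x  = inj₂ (m , m∈X , λ { (Any.here refl) _ → ⊀⇒≽ m⊀x ; (Any.there y∈) → bounds y∈ })

  greatest : (X : Subset n) → Empty X ⊎ ∃ (IsGreatest X)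
  greatest X with greatestAmong X (allFin n)
  ... | inj₁ none               = inj₁ λ (y , y∈X) → none (∈-allFin y) y∈X
  ... | inj₂ (m , m∈X , bounds) = inj₂ (m , m∈X , bounds (∈-allFin _))

module Extrema {n} {_≺_ : Rel (Fin n) 0ℓ} (sto : IsStrictTotalOrder _≡_ _≺_) where
  open StrictTotalOrderFacts sto
  open Greatest sto public

  IsLeast : Subset n → Fin n → Set
  IsLeast X m = m ∈ X × (∀ {y} → y ∈ X → m ≼ y)

  least : (X : Subset n) → Empty X ⊎ ∃ (IsLeast X)
  least X with Greatest.greatest (Flip.isStrictTotalOrder sto) X
  ... | inj₁ empty              = inj₁ empty
  ... | inj₂ (m , m∈X , bounds) = inj₂ (m , m∈X , λ y∈X → map₂ sym (bounds y∈X))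

module MatroidMT {n} {_≺_ : Rel (Fin n) 0ℓ} (_≺?_ : Decidable _≺_) (sto : IsStrictTotalOrder _≡_ _≺_)
  where
  open StrictTotalOrderFacts sto hiding (_≺?_)
  open Extrema sto

  ↓_ : Fin n → Subset n
  ↓ t = below _≺?_ t

  ↑_ : Fin n → Subset n
  ↑ t = below (flip _≺?_) t

  ∈↓⁺ : ∀ {x t} → x ≺ t → x ∈ ↓ t
  ∈↓⁺ {t = t} = ∈-tabulate⁺ (_≺? t)

  ∈↓⁻ : ∀ {x t} → x ∈ ↓ t → x ≺ t
  ∈↓⁻ {t = t} = ∈-tabulate⁻ (_≺? t)

  ∈↑⁺ : ∀ {x t} → t ≺ x → x ∈ ↑ t
  ∈↑⁺ {t = t} = ∈-tabulate⁺ (t ≺?_)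

  ∈↑⁻ : ∀ {x t} → x ∈ ↑ t → t ≺ x
  ∈↑⁻ {t = t} = ∈-tabulate⁻ (t ≺?_)

  ∉↑⁻ : ∀ {x t} → x ∉ ↑ t → x ≼ t
  ∉↑⁻ x∉↑t = ⊀⇒≽ (x∉↑t ∘ ∈↑⁺)

  ∁↑⊆↓ : ∀ {s t} → s ≺ t → ∁ (↑ s) ⊆ ↓ t
  ∁↑⊆↓ s≺t y∈ = ∈↓⁺ (≼-≺-trans (∉↑⁻ (x∈∁p⇒x∉p y∈)) s≺t)

  ∁↑-mono : ∀ {s t} → s ≼ t → ∁ (↑ s) ⊆ ∁ (↑ t)
  ∁↑-mono s≼t y∈ = x∉p⇒x∈∁p λ y∈↑t → x∈∁p⇒x∉p y∈ (∈↑⁺ (≼-≺-trans s≼t (∈↑⁻ y∈↑t)))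

  ∁↑≡↓∪⁅⁆ : ∀ t → ∁ (↑ t) ≡ (↓ t) ∪ ⁅ t ⁆
  ∁↑≡↓∪⁅⁆ t = ⊆-antisym to from
    where
    to : ∁ (↑ t) ⊆ (↓ t) ∪ ⁅ t ⁆
    to y∈ with ∉↑⁻ (x∈∁p⇒x∉p y∈)
    ... | inj₁ y≺t = p⊆p∪q ⁅ t ⁆ (∈↓⁺ y≺t)
    ... | inj₂ refl = q⊆p∪q (↓ t) ⁅ t ⁆ (x∈⁅x⁆ t)
    from : (↓ t) ∪ ⁅ t ⁆ ⊆ ∁ (↑ t)
    from y∈ = x∉p⇒x∈∁p λ y∈↑t → [ (λ y∈↓t → asym (∈↓⁻ y∈↓t) (∈↑⁻ y∈↑t))
                                  , (λ y∈t → irrefl (sym (x∈⁅y⁆⇒x≡y t y∈t)) (∈↑⁻ y∈↑t)) ]′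
                                  (x∈p∪q⁻ (↓ t) ⁅ t ⁆ y∈)

  ∣T∩∁↑t∣≡1+∣T∩↓t∣ : ∀ {T t} → t ∈ T → ∣ T ∩ ∁ (↑ t) ∣ ≡ suc ∣ T ∩ ↓ t ∣
  ∣T∩∁↑t∣≡1+∣T∩↓t∣ {T} {t} t∈T = begin
    ∣ T ∩ ∁ (↑ t) ∣          ≡⟨ cong ∣_∣ (∩-comm T _) ⟩
    ∣ ∁ (↑ t) ∩ T ∣          ≡⟨ cong (λ X → ∣ X ∩ T ∣) (∁↑≡↓∪⁅⁆ t) ⟩
    ∣ (↓ t ∪ ⁅ t ⁆) ∩ T ∣    ≡⟨ cong ∣_∣ ([p∪⁅x⁆]∩q≡[p∩q]∪⁅x⁆ (↓ t) T t∈T) ⟩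
    ∣ (↓ t ∩ T) ∪ ⁅ t ⁆ ∣    ≡⟨ ∣p∪⁅x⁆∣≡1+∣p∣ (λ t∈ → irrefl refl (∈↓⁻ (proj₁ (x∈p∩q⁻ (↓ t) T t∈)))) ⟩
    suc ∣ ↓ t ∩ T ∣          ≡⟨ cong (suc ∘ ∣_∣) (∩-comm (↓ t) T) ⟩
    suc ∣ T ∩ ↓ t ∣          ∎
    where open ≡-Reasoning

  next : ∀ T t → T ⊆ ∁ (↑ t) ⊎ ∃ λ m → m ∈ T × t ≺ m × T ∩ ↓ m ≡ T ∩ ∁ (↑ t)
  next T t with least (T ∩ ↑ t)
  ... | inj₁ empty = inj₁ λ y∈T → x∉p⇒x∈∁p λ y∈↑t → empty (_ , x∈p∩q⁺ (y∈T , y∈↑t))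
  ... | inj₂ (m , m∈ , minimal) with x∈p∩q⁻ T (↑ t) m∈
  ...   | m∈T , m∈↑t = inj₂ (m , m∈T , ∈↑⁻ m∈↑t , ⊆-antisym below-m (∩-mono ⊆-refl (∁↑⊆↓ (∈↑⁻ m∈↑t))))
    where
    below-m : T ∩ ↓ m ⊆ T ∩ ∁ (↑ t)
    below-m y∈ with x∈p∩q⁻ T (↓ m) y∈
    ... | y∈T , y∈↓m = x∈p∩q⁺ (y∈T , x∉p⇒x∈∁p λ y∈↑t → ≼⇒⊁ (minimal (x∈p∩q⁺ (y∈T , y∈↑t))) (∈↓⁻ y∈↓m))

  MT⇒∣I∩∁↑t∣≤∣T∩∁↑t∣ : ∀ {T I} → MT _≺?_ T I → ∀ t → ∣ I ∩ ∁ (↑ t) ∣ ≤ ∣ T ∩ ∁ (↑ t) ∣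
  MT⇒∣I∩∁↑t∣≤∣T∩∁↑t∣ {T} {I} (bounded , ∣I∣≤∣T∣) t with next T t
  ... | inj₁ T⊆∁↑t = begin
    ∣ I ∩ ∁ (↑ t) ∣ ≤⟨ ∣p∩q∣≤∣p∣ I _ ⟩
    ∣ I ∣           ≤⟨ ∣I∣≤∣T∣ ⟩
    ∣ T ∣           ≤⟨ p⊆q⇒∣p∣≤∣p∩q∣ T⊆∁↑t ⟩
    ∣ T ∩ ∁ (↑ t) ∣ ∎
    where open ≤-Reasoning
  ... | inj₂ (m , m∈T , t≺m , T∩↓m≡T∩∁↑t) = begin
    ∣ I ∩ ∁ (↑ t) ∣ ≤⟨ p⊆q⇒∣p∣≤∣q∣ {p = I ∩ ∁ (↑ t)} (∩-mono ⊆-refl (∁↑⊆↓ t≺m)) ⟩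
    ∣ I ∩ ↓ m ∣     ≤⟨ bounded m m∈T ⟩
    ∣ T ∩ ↓ m ∣     ≡⟨ cong ∣_∣ T∩↓m≡T∩∁↑t ⟩
    ∣ T ∩ ∁ (↑ t) ∣ ∎
    where open ≤-Reasoning

  rank-surjective : ∀ {T} k → k < ∣ T ∣ → ∃ λ t → t ∈ T × ∣ T ∩ ↓ t ∣ ≡ k
  rank-surjective {T} 0 0<∣T∣ with least T
  ... | inj₁ empty = ⊥-elim (<⇒≢ 0<∣T∣ (sym (Empty⇒∣p∣≡0 empty)))
  ... | inj₂ (m , m∈T , minimal) = m , m∈T , Empty⇒∣p∣≡0 λ (y , y∈) →
    ≼⇒⊁ (minimal (proj₁ (x∈p∩q⁻ T (↓ m) y∈))) (∈↓⁻ (proj₂ (x∈p∩q⁻ T (↓ m) y∈)))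
  rank-surjective {T} (suc k) k+1<∣T∣ with rank-surjective {T} k (<-trans (n<1+n k) k+1<∣T∣)
  ... | t , t∈T , refl with next T t
  ...   | inj₁ T⊆∁↑t = ⊥-elim (<⇒≱ k+1<∣T∣ (begin
    ∣ T ∣               ≤⟨ p⊆q⇒∣p∣≤∣p∩q∣ T⊆∁↑t ⟩
    ∣ T ∩ ∁ (↑ t) ∣     ≡⟨ ∣T∩∁↑t∣≡1+∣T∩↓t∣ t∈T ⟩
    suc ∣ T ∩ ↓ t ∣     ∎))
    where open ≤-Reasoning
  ...   | inj₂ (m , m∈T , _ , T∩↓m≡T∩∁↑t) = m , m∈T , trans (cong ∣_∣ T∩↓m≡T∩∁↑t) (∣T∩∁↑t∣≡1+∣T∩↓t∣ t∈T)

  extend-by-greatest : ∀ {T X B m} → MT _≺?_ T B → ∣ B ∣ < ∣ T ∣ →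
    (∀ t → ∣ T ∩ ∁ (↓ t) ∣ ≤ ∣ X ∩ ∁ (↓ t) ∣) → IsGreatest (X ∩ ∁ B) m → MT _≺?_ T (B ∪ ⁅ m ⁆)
  extend-by-greatest {T} {X} {B} {m} (bounded , _) ∣B∣<∣T∣ above (m∈X∖B , greatest) = bounded′ , size′
    where
    m∉B : m ∉ B
    m∉B = x∈∁p⇒x∉p (proj₂ (x∈p∩q⁻ X (∁ B) m∈X∖B))

    size′ : ∣ B ∪ ⁅ m ⁆ ∣ ≤ ∣ T ∣
    size′ = subst (_≤ ∣ T ∣) (sym (∣p∪⁅x⁆∣≡1+∣p∣ m∉B)) ∣B∣<∣T∣

    bounded′ : ∀ t → t ∈ T → ∣ (B ∪ ⁅ m ⁆) ∩ ↓ t ∣ ≤ ∣ T ∩ ↓ t ∣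
    bounded′ t t∈T with m ≺? t
    ... | no m⊀t = ≤-trans (p⊆q⇒∣p∣≤∣q∣ ([p∪⁅x⁆]∩q⊆p∩q B (↓ t) (m⊀t ∘ ∈↓⁻))) (bounded t t∈T)
    ... | yes m≺t = begin
      ∣ (B ∪ ⁅ m ⁆) ∩ ↓ t ∣ ≡⟨ cong ∣_∣ ([p∪⁅x⁆]∩q≡[p∩q]∪⁅x⁆ B (↓ t) (∈↓⁺ m≺t)) ⟩
      ∣ (B ∩ ↓ t) ∪ ⁅ m ⁆ ∣ ≡⟨ ∣p∪⁅x⁆∣≡1+∣p∣ (m∉B ∘ proj₁ ∘ x∈p∩q⁻ B (↓ t)) ⟩
      suc ∣ B ∩ ↓ t ∣       ≤⟨ k+∣p∣≤∣q∣⇒k+∣p∩r∣≤∣q∩r∣ 1 B T (↓ t) ∣B∣<∣T∣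
                                 (≤-trans (above t) (p⊆q⇒∣p∣≤∣q∣ X∩∁↓t⊆B∩∁↓t)) ⟩
      ∣ T ∩ ↓ t ∣           ∎
      where
      open ≤-Reasoning
      X∩∁↓t⊆B∩∁↓t : X ∩ ∁ (↓ t) ⊆ B ∩ ∁ (↓ t)
      X∩∁↓t⊆B∩∁↓t {y} y∈ with x∈p∩q⁻ X (∁ (↓ t)) y∈ | y ∈? B
      ... | _     , y∉↓t | yes y∈B = x∈p∩q⁺ (y∈B , y∉↓t)
      ... | y∈X , y∉↓t | no  y∉B = ⊥-elim (x∈∁p⇒x∉p y∉↓t
        (∈↓⁺ (≼-≺-trans (greatest (x∈p∩q⁺ (y∈X , x∉p⇒x∈∁p y∉B))) m≺t)))

  augment : ∀ {T X B} → MT _≺?_ T B → ∣ B ∣ < ∣ T ∣ → ∣ T ∣ ≤ ∣ X ∣ →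
    (∀ t → ∣ T ∩ ∁ (↓ t) ∣ ≤ ∣ X ∩ ∁ (↓ t) ∣) → ∃ λ x → x ∈ X × x ∉ B × MT _≺?_ T (B ∪ ⁅ x ⁆)
  augment {T} {X} {B} indep ∣B∣<∣T∣ ∣T∣≤∣X∣ above with greatest (X ∩ ∁ B)
  ... | inj₁ empty = ⊥-elim (<⇒≱ (<-≤-trans ∣B∣<∣T∣ ∣T∣≤∣X∣) (p⊆q⇒∣p∣≤∣q∣ X⊆B))
    where
    X⊆B : X ⊆ B
    X⊆B {x} x∈X with x ∈? B
    ... | yes x∈B = x∈B
    ... | no  x∉B = ⊥-elim (empty (x , x∈p∩q⁺ (x∈X , x∉p⇒x∈∁p x∉B)))
  ... | inj₂ (m , m-greatest@(m∈X∖B , _)) with x∈p∩q⁻ X (∁ B) m∈X∖B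
  ...   | m∈X , m∈∁B = m , m∈X , x∈∁p⇒x∉p m∈∁B , extend-by-greatest indep ∣B∣<∣T∣ above m-greatest

  basis⇒∣B∣≡∣T∣ : ∀ {T B} → IsBasis (MT _≺?_ T) B → ∣ B ∣ ≡ ∣ T ∣
  basis⇒∣B∣≡∣T∣ {T} {B} (indep@(_ , ∣B∣≤∣T∣) , maximal) with m≤n⇒m<n∨m≡n ∣B∣≤∣T∣
  ... | inj₂ ∣B∣≡∣T∣ = ∣B∣≡∣T∣
  ... | inj₁ ∣B∣<∣T∣ with augment {X = ⊤} indep ∣B∣<∣T∣ (p⊆q⇒∣p∣≤∣q∣ {p = T} ⊆⊤)
                             (λ t → p⊆q⇒∣p∣≤∣q∣ {p = T ∩ ∁ (↓ t)} (∩-mono ⊆⊤ ⊆-refl))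
  ...   | x , _ , x∉B , indep′ =
    ⊥-elim (x∉B (subst (x ∈_) (maximal _ indep′ (p⊆p∪q ⁅ x ⁆)) (q⊆p∪q B ⁅ x ⁆ (x∈⁅x⁆ x))))

  MT∧∣B∣≡∣T∣⇒basis : ∀ {T B} → MT _≺?_ T B → ∣ B ∣ ≡ ∣ T ∣ → IsBasis (MT _≺?_ T) B
  MT∧∣B∣≡∣T∣⇒basis {T} {B} indep ∣B∣≡∣T∣ = indep , λ J (_ , ∣J∣≤∣T∣) B⊆J →
    ⊆-antisym (p⊆q∧∣q∣≤∣p∣⇒q⊆p B⊆J (≤-trans ∣J∣≤∣T∣ (≤-reflexive (sym ∣B∣≡∣T∣)))) B⊆J

  independent-inside : ∀ {T X} → ∣ T ∣ ≤ ∣ X ∣ → (∀ t → ∣ T ∩ ∁ (↓ t) ∣ ≤ ∣ X ∩ ∁ (↓ t) ∣) →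
    ∀ k → k ≤ ∣ T ∣ → ∃ λ B → B ⊆ X × MT _≺?_ T B × ∣ B ∣ ≡ k
  independent-inside {T} {X} _ _ 0 _ =
    ⊥ , ⊥⊆ , ((λ t _ → p⊆q⇒∣p∣≤∣q∣ {p = ⊥ ∩ ↓ t} {q = T ∩ ↓ t} (∩-mono ⊥⊆ ⊆-refl)) , p⊆q⇒∣p∣≤∣q∣ {q = T} ⊥⊆)
    , ∣⊥∣≡0 n
  independent-inside {T} {X} ∣T∣≤∣X∣ above (suc k) k<∣T∣
    with independent-inside {T} {X} ∣T∣≤∣X∣ above k (<⇒≤ k<∣T∣)
  ... | B , B⊆X , indep , refl with augment {T} {X} {B} indep k<∣T∣ ∣T∣≤∣X∣ above
  ...   | x , x∈X , x∉B , indep′ =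
    B ∪ ⁅ x ⁆ , p⊆q∧x∈q⇒p∪⁅x⁆⊆q B⊆X x∈X , indep′ , ∣p∪⁅x⁆∣≡1+∣p∣ {p = B} x∉B

  basis-inside : ∀ {T X} → ∣ T ∣ ≤ ∣ X ∣ → (∀ t → ∣ T ∩ ∁ (↓ t) ∣ ≤ ∣ X ∩ ∁ (↓ t) ∣) →
    ∃ λ B → B ⊆ X × IsBasis (MT _≺?_ T) B
  basis-inside {T} {X} ∣T∣≤∣X∣ above with independent-inside {T} {X} ∣T∣≤∣X∣ above ∣ T ∣ ≤-refl
  ... | B , B⊆X , indep , ∣B∣≡∣T∣ = B , B⊆X , MT∧∣B∣≡∣T∣⇒basis indep ∣B∣≡∣T∣

  MT⇔FreedomIndep : ∀ {T r} (F : Fin (suc r) → Subset n) → ∣ T ∣ ≡ r → F (fromℕ r) ≡ ⊤ →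
    (∀ {t} → t ∈ T → ∀ i → toℕ i ≡ ∣ T ∩ ↓ t ∣ → F i ≡ ↓ t) →
    ∀ I → MT _≺?_ T I ⇔ FreedomIndep r F I
  MT⇔FreedomIndep {T} {r} F ∣T∣≡r F-top F≡↓ I = mk⇔ to from
    where
    to : MT _≺?_ T I → FreedomIndep r F I
    to (bounded , ∣I∣≤∣T∣) i with toℕ i ℕ.<? r
    ... | yes i<r with rank-surjective {T} (toℕ i) (subst (toℕ i <_) (sym ∣T∣≡r) i<r)
    ...   | t , t∈T , rank≡i = begin
      ∣ I ∩ F i ∣ ≡⟨ cong (λ X → ∣ I ∩ X ∣) (F≡↓ t∈T i (sym rank≡i)) ⟩
      ∣ I ∩ ↓ t ∣ ≤⟨ bounded t t∈T ⟩
      ∣ T ∩ ↓ t ∣ ≡⟨ rank≡i ⟩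
      toℕ i       ∎
      where open ≤-Reasoning
    to (bounded , ∣I∣≤∣T∣) i | no i≮r = begin
      ∣ I ∩ F i ∣ ≤⟨ ∣p∩q∣≤∣p∣ I (F i) ⟩
      ∣ I ∣       ≤⟨ ∣I∣≤∣T∣ ⟩
      ∣ T ∣       ≡⟨ ∣T∣≡r ⟩
      r           ≤⟨ ≮⇒≥ i≮r ⟩
      toℕ i       ∎
      where open ≤-Reasoning

    from : FreedomIndep r F I → MT _≺?_ T I
    from indep = bounded , ∣I∣≤∣T∣
      where
      bounded : ∀ t → t ∈ T → ∣ I ∩ ↓ t ∣ ≤ ∣ T ∩ ↓ t ∣
      bounded t t∈T = begin
        ∣ I ∩ ↓ t ∣ ≡⟨ cong (λ X → ∣ I ∩ X ∣) (F≡↓ t∈T i (toℕ-fromℕ< _)) ⟨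
        ∣ I ∩ F i ∣ ≤⟨ indep i ⟩
        toℕ i       ≡⟨ toℕ-fromℕ< _ ⟩
        ∣ T ∩ ↓ t ∣ ∎
        where
        open ≤-Reasoning
        i : Fin (suc r)
        i = fromℕ< (s≤s (≤-trans (∣p∩q∣≤∣p∣ T (↓ t)) (≤-reflexive ∣T∣≡r)))
      ∣I∣≤∣T∣ : ∣ I ∣ ≤ ∣ T ∣
      ∣I∣≤∣T∣ = begin
        ∣ I ∣               ≡⟨ cong ∣_∣ (∩-identityʳ I) ⟨
        ∣ I ∩ ⊤ ∣           ≡⟨ cong (λ X → ∣ I ∩ X ∣) F-top ⟨
        ∣ I ∩ F (fromℕ r) ∣ ≤⟨ indep (fromℕ r) ⟩
        toℕ (fromℕ r)       ≡⟨ toℕ-fromℕ r ⟩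
        r                   ≡⟨ ∣T∣≡r ⟨
        ∣ T ∣               ∎
        where open ≤-Reasoning

  -- For i < ∣ T ∣, F i is the paper's T_i = ↓ t_{i+1}.
  MT-isFreedom : ∀ T → IsFreedom (MT _≺?_ T)
  MT-isFreedom T = ∣ T ∣ , F , (F-top , F-strict) , MT⇔FreedomIndep F refl F-top F≡↓
    where
    F : Fin (suc ∣ T ∣) → Subset n
    F i = tabulate (does ∘ λ s → ∣ T ∩ ∁ (↑ s) ∣ ℕ.≤? toℕ i)

    ∈F⁺ : ∀ {s i} → ∣ T ∩ ∁ (↑ s) ∣ ≤ toℕ i → s ∈ F i
    ∈F⁺ {i = i} = ∈-tabulate⁺ (λ s → ∣ T ∩ ∁ (↑ s) ∣ ℕ.≤? toℕ i)

    ∈F⁻ : ∀ {s i} → s ∈ F i → ∣ T ∩ ∁ (↑ s) ∣ ≤ toℕ i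
    ∈F⁻ {i = i} = ∈-tabulate⁻ (λ s → ∣ T ∩ ∁ (↑ s) ∣ ℕ.≤? toℕ i)

    F-top : F (fromℕ ∣ T ∣) ≡ ⊤
    F-top = ⊆-antisym ⊆⊤ λ {s} _ → ∈F⁺ (subst (∣ T ∩ ∁ (↑ s) ∣ ≤_) (sym (toℕ-fromℕ _)) (∣p∩q∣≤∣p∣ T _))

    F≡↓ : ∀ {t} → t ∈ T → ∀ i → toℕ i ≡ ∣ T ∩ ↓ t ∣ → F i ≡ ↓ t
    F≡↓ {t} t∈T i i≡rank = ⊆-antisym F⊆↓ ↓⊆F
      where
      F⊆↓ : F i ⊆ ↓ t
      F⊆↓ {s} s∈F with s ≺? t
      ... | yes s≺t = ∈↓⁺ s≺t
      ... | no  s⊀t = ⊥-elim (<⇒≱ (begin-strict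
        ∣ T ∩ ↓ t ∣         <⟨ n<1+n _ ⟩
        suc ∣ T ∩ ↓ t ∣     ≡⟨ ∣T∩∁↑t∣≡1+∣T∩↓t∣ t∈T ⟨
        ∣ T ∩ ∁ (↑ t) ∣     ∎) (begin
        ∣ T ∩ ∁ (↑ t) ∣     ≤⟨ p⊆q⇒∣p∣≤∣q∣ {p = T ∩ ∁ (↑ t)} (∩-mono ⊆-refl (∁↑-mono (⊀⇒≽ s⊀t))) ⟩
        ∣ T ∩ ∁ (↑ s) ∣     ≤⟨ ∈F⁻ s∈F ⟩
        toℕ i               ≡⟨ i≡rank ⟩
        ∣ T ∩ ↓ t ∣         ∎))
        where open ≤-Reasoning
      ↓⊆F : ↓ t ⊆ F i
      ↓⊆F {s} s∈↓t = ∈F⁺ (begin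
        ∣ T ∩ ∁ (↑ s) ∣ ≤⟨ p⊆q⇒∣p∣≤∣q∣ {p = T ∩ ∁ (↑ s)} (∩-mono ⊆-refl (∁↑⊆↓ (∈↓⁻ s∈↓t))) ⟩
        ∣ T ∩ ↓ t ∣     ≡⟨ i≡rank ⟨
        toℕ i           ∎)
        where open ≤-Reasoning

    F-strict : ∀ (i : Fin ∣ T ∣) → F (inject₁ i) ⊂ F (fsuc i)
    F-strict i with rank-surjective {T} (toℕ i) (toℕ<n i)
    ... | t , t∈T , rank≡i = F-mono , t , ∈F⁺ (≤-reflexive ∣T∩∁↑t∣≡1+i) , λ t∈F → 1+n≰n (begin
      suc (toℕ i)         ≡⟨ ∣T∩∁↑t∣≡1+i ⟨
      ∣ T ∩ ∁ (↑ t) ∣     ≤⟨ ∈F⁻ t∈F ⟩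
      toℕ (inject₁ i)     ≡⟨ toℕ-inject₁ i ⟩
      toℕ i               ∎)
      where
      open ≤-Reasoning
      ∣T∩∁↑t∣≡1+i : ∣ T ∩ ∁ (↑ t) ∣ ≡ suc (toℕ i)
      ∣T∩∁↑t∣≡1+i = trans (∣T∩∁↑t∣≡1+∣T∩↓t∣ t∈T) (cong suc rank≡i)
      F-mono : F (inject₁ i) ⊆ F (fsuc i)
      F-mono s∈F = ∈F⁺ (≤-trans (∈F⁻ s∈F) (≤-trans (≤-reflexive (toℕ-inject₁ i)) (n≤1+n _)))

module Duality {n} {_≺_ : Rel (Fin n) 0ℓ} (_≺?_ : Decidable _≺_) (sto : IsStrictTotalOrder _≡_ _≺_)
  where
  open MatroidMT _≺?_ sto
  private module Reversed = MatroidMT (flip _≺?_) (Flip.isStrictTotalOrder sto)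

  Dual⇒MTᵒᵖ : ∀ {T I} → Dual (MT _≺?_ T) I → MT (flip _≺?_) (∁ T) I
  Dual⇒MTᵒᵖ {T} {I} (B , basis , disjoint) = bounded , size
    where
    ∣B∣≡∣T∣ : ∣ B ∣ ≡ ∣ T ∣
    ∣B∣≡∣T∣ = basis⇒∣B∣≡∣T∣ {T} {B} basis

    B⊆∁I : B ⊆ ∁ I
    B⊆∁I x∈B = x∉p⇒x∈∁p λ x∈I → disjoint x∈I x∈B

    ∣T∣≤∣∁I∣ : ∣ T ∣ ≤ ∣ ∁ I ∣
    ∣T∣≤∣∁I∣ = ≤-trans (≤-reflexive (sym ∣B∣≡∣T∣)) (p⊆q⇒∣p∣≤∣q∣ B⊆∁I)

    size : ∣ I ∣ ≤ ∣ ∁ T ∣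
    size = ∣p∣≤∣∁q∣⇒∣q∣≤∣∁p∣ T I ∣T∣≤∣∁I∣

    bounded : ∀ t → t ∈ ∁ T → ∣ I ∩ ↑ t ∣ ≤ ∣ ∁ T ∩ ↑ t ∣
    bounded t _ = ∣p∩r∣≤∣∁q∩r∣⇒∣q∩r∣≤∣∁p∩r∣ T I (↑ t) (begin
      ∣ T ∩ ↑ t ∣   ≤⟨ k+∣p∣≤∣q∣⇒k+∣p∩r∣≤∣q∩r∣ 0 T B (↑ t) (≤-reflexive (sym ∣B∣≡∣T∣))
                         (MT⇒∣I∩∁↑t∣≤∣T∩∁↑t∣ {T} {B} (proj₁ basis) t) ⟩
      ∣ B ∩ ↑ t ∣   ≤⟨ p⊆q⇒∣p∣≤∣q∣ {p = B ∩ ↑ t} (∩-mono B⊆∁I ⊆-refl) ⟩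
      ∣ ∁ I ∩ ↑ t ∣ ∎)
      where open ≤-Reasoning

  MTᵒᵖ⇒Dual : ∀ {T I} → MT (flip _≺?_) (∁ T) I → Dual (MT _≺?_ T) I
  MTᵒᵖ⇒Dual {T} {I} indep@(_ , size) with basis-inside {T} {∁ I} (∣p∣≤∣∁q∣⇒∣q∣≤∣∁p∣ I T size)
    (λ t → ∣p∩r∣≤∣∁q∩r∣⇒∣q∩r∣≤∣∁p∩r∣ I T (∁ (↓ t)) (Reversed.MT⇒∣I∩∁↑t∣≤∣T∩∁↑t∣ {∁ T} {I} indep t))
  ... | B , B⊆∁I , basis = B , basis , λ x∈I x∈B → x∈∁p⇒x∉p (B⊆∁I x∈B) x∈I

  MT-dual : ∀ T I → Dual (MT _≺?_ T) I ⇔ MT (flip _≺?_) (∁ T) I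
  MT-dual T I = mk⇔ Dual⇒MTᵒᵖ MTᵒᵖ⇒Dual

least-index : ∀ {r} {P : Pred (Fin (suc r)) 0ℓ} → (∀ i → Dec (P i)) → Fin (suc r)
least-index {0}     _  = zero
least-index {suc r} P? with P? zero
... | yes _ = zero
... | no  _ = fsuc (least-index (P? ∘ fsuc))

least-index-spec : ∀ {r} {P : Pred (Fin (suc r)) 0ℓ} (P? : ∀ i → Dec (P i)) →
  (∀ (j : Fin r) → P (inject₁ j) → P (fsuc j)) → P (fromℕ r) →
  ∀ i → P i ⇔ least-index P? Fin.≤ i
least-index-spec {0} P? _ P-top zero = mk⇔ (λ _ → z≤n) (λ _ → P-top)
least-index-spec {suc r} P? up P-top i with P? zero
least-index-spec {suc r} {P} P? up P-top zero     | yes P0 = mk⇔ (λ _ → z≤n) (λ _ → P0)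
least-index-spec {suc r} {P} P? up P-top (fsuc i) | yes P0 = mk⇔ (λ _ → z≤n) λ _ →
  Equivalence.from (tail i) (≤-trans (Equivalence.to (tail zero) (up zero P0)) z≤n)
  where
  tail : ∀ i → P (fsuc i) ⇔ least-index (P? ∘ fsuc) Fin.≤ i
  tail = least-index-spec (P? ∘ fsuc) (up ∘ fsuc) P-top
least-index-spec {suc r} {P} P? up P-top zero     | no ¬P0 = mk⇔ (⊥-elim ∘ ¬P0) λ ()
least-index-spec {suc r} {P} P? up P-top (fsuc i) | no ¬P0 =
  mk⇔ (s≤s ∘ Equivalence.to tail) (Equivalence.from tail ∘ s≤s⁻¹)
  where
  tail : P (fsuc i) ⇔ least-index (P? ∘ fsuc) Fin.≤ i
  tail = least-index-spec (P? ∘ fsuc) (up ∘ fsuc) P-top i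

module FreedomAsMT {n r} (F : Fin (suc r) → Subset n) (flag : IsFlag r F) where

  level : Fin n → Fin (suc r)
  level s = least-index (λ i → s ∈? F i)

  ∈F⇔level≤ : ∀ {s} i → s ∈ F i ⇔ level s Fin.≤ i
  ∈F⇔level≤ {s} = least-index-spec (λ i → s ∈? F i) (λ j → proj₁ (proj₂ flag j))
                                   (subst (s ∈_) (sym (proj₁ flag)) ∈⊤)

  -- Order S by level first and by index second, so that every F i is an initial segment.
  key : Fin n → Fin (suc r ℕ.* n)
  key s = combine (level s) s

  _≺_ : Rel (Fin n) 0ℓ
  _≺_ = Fin._<_ on key

  ≺-isStrictTotalOrder : IsStrictTotalOrder _≡_ _≺_
  ≺-isStrictTotalOrder =
    OrderMonomorphism.isStrictTotalOrder key-isOrderMonomorphism FinP.<-isStrictTotalOrder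
    where
    key-isOrderMonomorphism : IsOrderMonomorphism _≡_ _≡_ _≺_ Fin._<_ key
    key-isOrderMonomorphism = record
      { isOrderHomomorphism = record { cong = cong key ; mono = λ s≺t → s≺t }
      ; injective           = λ {s} {t} → combine-injectiveʳ (level s) s (level t) t
      ; cancel              = λ s≺t → s≺t
      }

  _≺?_ : Decidable _≺_
  _≺?_ = IsStrictTotalOrder._<?_ ≺-isStrictTotalOrder

  open StrictTotalOrderFacts ≺-isStrictTotalOrder hiding (_≺?_)
  open Extrema ≺-isStrictTotalOrder
  open MatroidMT _≺?_ ≺-isStrictTotalOrder using (↓_; ∈↓⁺; ∈↓⁻; MT⇔FreedomIndep)

  level<⇒≺ : ∀ {s t} → level s Fin.< level t → s ≺ t
  level<⇒≺ {s} {t} = combine-monoˡ-< s t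

  ≺⇒level≤ : ∀ {s t} → s ≺ t → level s Fin.≤ level t
  ≺⇒level≤ s≺t = ≮⇒≥ λ t<s → asym s≺t (level<⇒≺ t<s)

  block : Fin r → Subset n
  block j = tabulate (does ∘ λ s → level s FinP.≟ fsuc j)

  block-nonempty : ∀ j → Nonempty (block j)
  block-nonempty j with proj₂ (proj₂ flag j)
  ... | x , x∈F[1+j] , x∉F[j] = x , ∈-tabulate⁺ (λ s → level s FinP.≟ fsuc j) (toℕ-injective (≤-antisym
    (Equivalence.to (∈F⇔level≤ (fsuc j)) x∈F[1+j])
    (≰⇒> λ level≤j → x∉F[j] (Equivalence.from (∈F⇔level≤ (inject₁ j))
                               (≤-trans level≤j (≤-reflexive (sym (toℕ-inject₁ j))))))))

  first : ∀ j → ∃ (IsLeast (block j))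
  first j with least (block j)
  ... | inj₁ empty = ⊥-elim (empty (block-nonempty j))
  ... | inj₂ m     = m

  -- t j is the paper's t_{j+1}.
  t : Fin r → Fin n
  t j = proj₁ (first j)

  level-t : ∀ j → level (t j) ≡ fsuc j
  level-t j = ∈-tabulate⁻ (λ s → level s FinP.≟ fsuc j) (proj₁ (proj₂ (first j)))

  ↓t≡F : ∀ j → ↓ t j ≡ F (inject₁ j)
  ↓t≡F j = ⊆-antisym ↓t⊆F F⊆↓t
    where
    ↓t⊆F : ↓ t j ⊆ F (inject₁ j)
    ↓t⊆F {s} s∈↓t with level s Fin.≤? inject₁ j
    ... | yes level≤j = Equivalence.from (∈F⇔level≤ (inject₁ j)) level≤j
    ... | no  level≰j = ⊥-elim (≼⇒⊁ (proj₂ (proj₂ (first j)) s∈block) (∈↓⁻ s∈↓t))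
      where
      s∈block : s ∈ block j
      s∈block = ∈-tabulate⁺ (λ s → level s FinP.≟ fsuc j) (toℕ-injective (≤-antisym
        (≤-trans (≺⇒level≤ (∈↓⁻ s∈↓t)) (≤-reflexive (cong toℕ (level-t j))))
        (≤-trans (≤-reflexive (cong suc (sym (toℕ-inject₁ j)))) (≰⇒> level≰j))))
    F⊆↓t : F (inject₁ j) ⊆ ↓ t j
    F⊆↓t s∈F = ∈↓⁺ (level<⇒≺ (begin-strict
      toℕ (level _)   ≤⟨ Equivalence.to (∈F⇔level≤ (inject₁ j)) s∈F ⟩
      toℕ (inject₁ j) ≡⟨ toℕ-inject₁ j ⟩
      toℕ j           <⟨ n<1+n _ ⟩
      suc (toℕ j)     ≡⟨ cong toℕ (level-t j) ⟨
      toℕ (level (t j)) ∎))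
      where open ≤-Reasoning

  T : Subset n
  T = tabulate (does ∘ λ s → any? λ j → s FinP.≟ t j)

  t∈T : ∀ j → t j ∈ T
  t∈T j = ∈-tabulate⁺ (λ s → any? λ j → s FinP.≟ t j) (j , refl)

  ∈T⁻ : ∀ {s} → s ∈ T → ∃ λ j → s ≡ t j
  ∈T⁻ = ∈-tabulate⁻ (λ s → any? λ j → s FinP.≟ t j)

  level≤ : ℕ → Subset n
  level≤ k = tabulate (does ∘ λ s → toℕ (level s) ℕ.≤? k)

  ∈level≤⁺ : ∀ {s k} → toℕ (level s) ≤ k → s ∈ level≤ k
  ∈level≤⁺ {k = k} = ∈-tabulate⁺ (λ s → toℕ (level s) ℕ.≤? k)

  ∈level≤⁻ : ∀ {s k} → s ∈ level≤ k → toℕ (level s) ≤ k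
  ∈level≤⁻ {k = k} = ∈-tabulate⁻ (λ s → toℕ (level s) ℕ.≤? k)

  F≡level≤ : ∀ i → F i ≡ level≤ (toℕ i)
  F≡level≤ i = ⊆-antisym (∈level≤⁺ ∘ Equivalence.to (∈F⇔level≤ i))
                         (Equivalence.from (∈F⇔level≤ i) ∘ ∈level≤⁻)

  t∈level≤⇔ : ∀ {j k} → t j ∈ level≤ k ⇔ toℕ j < k
  t∈level≤⇔ {j} = mk⇔ (λ t∈ → subst (_≤ _) (cong toℕ (level-t j)) (∈level≤⁻ t∈))
                      (λ j<k → ∈level≤⁺ (subst (_≤ _) (cong toℕ (sym (level-t j))) j<k))

  T∩level≤[1+k]≡ : ∀ {k} (k<r : k < r) → T ∩ level≤ (suc k) ≡ (T ∩ level≤ k) ∪ ⁅ t (fromℕ< k<r) ⁆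
  T∩level≤[1+k]≡ {k} k<r = ⊆-antisym to from
    where
    to : T ∩ level≤ (suc k) ⊆ (T ∩ level≤ k) ∪ ⁅ t (fromℕ< k<r) ⁆
    to s∈ with x∈p∩q⁻ T _ s∈
    ... | s∈T , s∈level≤ with ∈T⁻ s∈T
    ...   | j , refl with m≤n⇒m<n∨m≡n (s≤s⁻¹ (Equivalence.to t∈level≤⇔ s∈level≤))
    ...     | inj₁ j<k = p⊆p∪q _ (x∈p∩q⁺ (s∈T , Equivalence.from t∈level≤⇔ j<k))
    ...     | inj₂ j≡k = q⊆p∪q _ _ (subst (λ i → t j ∈ ⁅ t i ⁆)
                                           (toℕ-injective (trans j≡k (sym (toℕ-fromℕ< k<r)))) (x∈⁅x⁆ (t j)))
    from : (T ∩ level≤ k) ∪ ⁅ t (fromℕ< k<r) ⁆ ⊆ T ∩ level≤ (suc k)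
    from s∈ with x∈p∪q⁻ (T ∩ level≤ k) _ s∈
    ... | inj₁ s∈T∩level≤k =
      ∩-mono ⊆-refl (λ s∈level≤ → ∈level≤⁺ (m≤n⇒m≤1+n (∈level≤⁻ s∈level≤))) s∈T∩level≤k
    ... | inj₂ s∈⁅t⁆ = subst (_∈ T ∩ level≤ (suc k)) (sym (x∈⁅y⁆⇒x≡y _ s∈⁅t⁆))
      (x∈p∩q⁺ (t∈T _ , Equivalence.from t∈level≤⇔ (s≤s (≤-reflexive (toℕ-fromℕ< k<r)))))

  ∣T∩level≤k∣≡k : ∀ k → k ≤ r → ∣ T ∩ level≤ k ∣ ≡ k
  ∣T∩level≤k∣≡k 0 _ = Empty⇒∣p∣≡0 λ (s , s∈) → nothing-at-level-0 (x∈p∩q⁻ T _ s∈)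
    where
    nothing-at-level-0 : ∀ {s} → ¬ (s ∈ T × s ∈ level≤ 0)
    nothing-at-level-0 (s∈T , s∈level≤0) with ∈T⁻ s∈T
    ... | j , refl with Equivalence.to t∈level≤⇔ s∈level≤0
    ...   | ()
  ∣T∩level≤k∣≡k (suc k) k<r = begin
    ∣ T ∩ level≤ (suc k) ∣                   ≡⟨ cong ∣_∣ (T∩level≤[1+k]≡ k<r) ⟩
    ∣ (T ∩ level≤ k) ∪ ⁅ t (fromℕ< k<r) ⁆ ∣  ≡⟨ ∣p∪⁅x⁆∣≡1+∣p∣ t∉ ⟩
    suc ∣ T ∩ level≤ k ∣                     ≡⟨ cong suc (∣T∩level≤k∣≡k k (<⇒≤ k<r)) ⟩
    suc k                                    ∎
    where
    open ≡-Reasoning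
    t∉ : t (fromℕ< k<r) ∉ T ∩ level≤ k
    t∉ t∈ = <-irrefl (toℕ-fromℕ< k<r) (Equivalence.to t∈level≤⇔ (proj₂ (x∈p∩q⁻ T _ t∈)))

  ∣T∩F∣≡ : ∀ i → ∣ T ∩ F i ∣ ≡ toℕ i
  ∣T∩F∣≡ i = trans (cong (λ X → ∣ T ∩ X ∣) (F≡level≤ i)) (∣T∩level≤k∣≡k (toℕ i) (s≤s⁻¹ (toℕ<n i)))

  ∣T∣≡r : ∣ T ∣ ≡ r
  ∣T∣≡r = begin
    ∣ T ∣               ≡⟨ cong ∣_∣ (∩-identityʳ T) ⟨
    ∣ T ∩ ⊤ ∣           ≡⟨ cong (λ X → ∣ T ∩ X ∣) (proj₁ flag) ⟨
    ∣ T ∩ F (fromℕ r) ∣ ≡⟨ ∣T∩F∣≡ (fromℕ r) ⟩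
    toℕ (fromℕ r)       ≡⟨ toℕ-fromℕ r ⟩
    r                   ∎
    where open ≡-Reasoning

  F≡↓ : ∀ {s} → s ∈ T → ∀ i → toℕ i ≡ ∣ T ∩ ↓ s ∣ → F i ≡ ↓ s
  F≡↓ s∈T i i≡rank with ∈T⁻ s∈T
  ... | j , refl = trans (cong F i≡inject₁j) (sym (↓t≡F j))
    where
    i≡inject₁j : i ≡ inject₁ j
    i≡inject₁j = toℕ-injective (begin
      toℕ i               ≡⟨ i≡rank ⟩
      ∣ T ∩ ↓ t j ∣       ≡⟨ cong (λ X → ∣ T ∩ X ∣) (↓t≡F j) ⟩
      ∣ T ∩ F (inject₁ j) ∣ ≡⟨ ∣T∩F∣≡ (inject₁ j) ⟩
      toℕ (inject₁ j)     ∎)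
      where open ≡-Reasoning

  FreedomIndep⇔MT : ∀ I → FreedomIndep r F I ⇔ MT _≺?_ T I
  FreedomIndep⇔MT I = ⇔-sym (MT⇔FreedomIndep F ∣T∣≡r (proj₁ flag) F≡↓ I)

Dual-resp : ∀ {n} {Ind Ind′ : Indep n} → (∀ I → Ind I ⇔ Ind′ I) → ∀ {I} → Dual Ind I → Dual Ind′ I
Dual-resp Ind⇔Ind′ (B , (indep , maximal) , disjoint) =
  B , (Equivalence.to (Ind⇔Ind′ B) indep , λ J indep′ → maximal J (Equivalence.from (Ind⇔Ind′ J) indep′))
  , disjoint

IsFreedom-resp : ∀ {n} {Ind Ind′ : Indep n} → (∀ I → Ind I ⇔ Ind′ I) → IsFreedom Ind′ → IsFreedom Ind
IsFreedom-resp Ind⇔Ind′ (r , F , flag , Ind′⇔F) = r , F , flag , λ I → Ind′⇔F I ⇔-∘ Ind⇔Ind′ I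

Dual-isFreedom : ∀ {n} (Ind : Indep n) → IsFreedom Ind → IsFreedom (Dual Ind)
Dual-isFreedom Ind (r , F , flag , Ind⇔F) =
  IsFreedom-resp Dual⇔MTᵒᵖ
    (MatroidMT.MT-isFreedom (flip _≺?_) (Flip.isStrictTotalOrder ≺-isStrictTotalOrder) (∁ T))
  where
  open FreedomAsMT F flag
  Ind⇔MT : ∀ I → Ind I ⇔ MT _≺?_ T I
  Ind⇔MT I = FreedomIndep⇔MT I ⇔-∘ Ind⇔F I
  Dual⇔MTᵒᵖ : ∀ I → Dual Ind I ⇔ MT (flip _≺?_) (∁ T) I
  Dual⇔MTᵒᵖ I = Duality.MT-dual _≺?_ ≺-isStrictTotalOrder T I
            ⇔-∘ mk⇔ (Dual-resp Ind⇔MT) (Dual-resp (⇔-sym ∘ Ind⇔MT))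

proposition6p3 :
    ((n : ℕ) (R : Rel (Fin n) 0ℓ) (R? : Decidable R) → IsStrictTotalOrder _≡_ R →
      (T I : Subset n) →
      Dual (MT R? T) I ⇔ MT {R = flip R} (flip R?) (∁ T) I)
    × ((n : ℕ) (Ind : Indep n) → IsFreedom Ind → IsFreedom (Dual Ind))
proposition6p3 = (λ _ _ R? sto → Duality.MT-dual R? sto) , λ _ → Dual-isFreedom
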